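{- Let $n$ be a positive integer. Then $\mathsf{NAADT}(\mathsf{OMB}_n)=n$ and $\mathsf{D}^{\rightarrow}_{\mathrm{cc}}(\mathsf{OMB}_n\circ\mathsf{AND})=\lceil\log(n+1)\rceil$.
   Context: $\mathsf{OMB}_n:\{0,1\}^n\to\{0,1\}$ is defined by $\mathsf{OMB}_n(x)=1$ if $\max\{i\in[n]:x_i=0\}$ is odd, $\mathsf{OMB}_n(x)=0$ if this maximum is even, and $\mathsf{OMB}_n(1^n)=0$. For $S\subseteq[n]$, $\mathsf{AND}_S(x)=\prod_{i\in S}x_i$. $\mathsf{NAADT}(f)$ is the minimum $k$ such that there exist $S_1,\dots,S_k\subseteq[n]$ for which $f(x)$ is determined by $(\mathsf{AND}_{S_1}(x),\dots,\mathsf{AND}_{S_k}(x))$ for all $x$. $f\circ\mathsf{AND}$ is the two-party function $(x,y)\mapsto f(x_1\wedge y_1,\dots,x_n\wedge y_n)$ with Alice holding $x$ and Bob $y$. $\mathsf{D}^{\rightarrow}_{\mathrm{cc}}$ is deterministic one-way communication complexity. Logarithms are base 2. -}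

module Defs where

open import Data.Nat using (ℕ; zero; suc; _≤_; _+_)
open import Data.Bool using (Bool; true; false; _∧_; if_then_else_)
open import Data.Maybe using (Maybe; just; nothing; maybe)
open import Data.Vec using (Vec; []; _∷_; zipWith)
open import Data.Fin using (Fin)
open import Data.Fin.Subset using (Subset)
open import Data.Product using (Σ; _×_)
open import Relation.Binary.PropositionalEquality using (_≡_)

-- Inputs x ∈ {0,1}^n are Vec Bool n; entry at (0-based) Fin-index i is x_{i+1}.
-- 0 ↔ false, 1 ↔ true.

-- maximal 1-based position i with x_i = 0, or nothing if x = 1^n
lastZero : ∀ {n} → Vec Bool n → Maybe ℕ
lastZero [] = nothing
lastZero (b ∷ xs) with lastZero xs
... | just k  = just (suc k)
... | nothing = if b then nothing else just 1

isOdd : ℕ → Bool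
isOdd zero = false
isOdd (suc zero) = true
isOdd (suc (suc k)) = isOdd k

OMB : (n : ℕ) → Vec Bool n → Bool
OMB n x = maybe isOdd false (lastZero x)

AND : ∀ {n} → Subset n → Vec Bool n → Bool
AND [] [] = true
AND (s ∷ S) (b ∷ x) = (if s then b else true) ∧ AND S x

DeterminedBy : ∀ {n k} → (Vec Bool n → Bool) → (Fin k → Subset n) → Set
DeterminedBy f S = ∀ x y → (∀ j → AND (S j) x ≡ AND (S j) y) → f x ≡ f y

NAADT-admits : ∀ {n} → (Vec Bool n → Bool) → ℕ → Set
NAADT-admits {n} f k = Σ (Fin k → Subset n) (DeterminedBy f)

NAADT-is : ∀ {n} → (Vec Bool n → Bool) → ℕ → Set
NAADT-is f m = NAADT-admits f m × (∀ k → NAADT-admits f k → m ≤ k)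

_∘AND : ∀ {n} → (Vec Bool n → Bool) → Vec Bool n → Vec Bool n → Bool
(f ∘AND) x y = f (zipWith _∧_ x y)

OneWayProtocol : {X Y : Set} → (X → Y → Bool) → ℕ → Set
OneWayProtocol {X} {Y} F c =
  Σ (X → Vec Bool c) λ alice →
  Σ (Vec Bool c → Y → Bool) λ bob →
  ∀ x y → bob (alice x) y ≡ F x y

D-oneway-is : {X Y : Set} → (X → Y → Bool) → ℕ → Set
D-oneway-is F m = OneWayProtocol F m × (∀ c → OneWayProtocol F c → m ≤ c)

-- Write ℓ(x) for the position of the last zero of x (0 if there is none), so that
-- OMB_n(x) is the parity of ℓ(x) and ℓ(x ∧ y) = max(ℓ(x), ℓ(y)).
--
-- NAADT: the n singletons AND_{i} read off x. Conversely, the prefixes z_m = 0^m 1^(n-m)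
-- have OMB_n(z_m) ≠ OMB_n(z_{m+1}), while AND_S(z_m) = AND_S(z_{m+1}) unless m+1 is the least
-- element of S; so every position must be the least element of some queried S.
--
-- One-way: Alice sends ℓ(x) ∈ {0,…,n} in binary and Bob outputs the parity of max(ℓ(x), ℓ(y)).
-- Conversely the rows z_0, …, z_n of OMB_n ∘ AND are pairwise distinct (rows z_a and z_b with
-- a < b differ on column z_0 or z_{a+1}), so Alice needs at least n + 1 distinct messages.
module Submission where

open import Defs
open import Data.Nat using (ℕ; _+_; _≤_)
open import Data.Nat.Logarithm using (⌈log₂_⌉)
open import Data.Product using (_×_)

open import Data.Bool using (Bool; true; false; _∧_; not)
open import Data.Bool.Properties using (∧-identityʳ)
open import Data.Fin using (Fin; zero; suc; toℕ; fromℕ<)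
open import Data.Fin.Properties
  using (2↔Bool; *↔×; toℕ<n; toℕ≤pred[n]; toℕ-fromℕ<; toℕ-injective; injective⇒≤; ¬∀⟶∃¬; any?; _≟_)
open import Data.Fin.Subset using (Subset; ⁅_⁆) renaming (⊥ to ∅)
open import Data.Maybe using (Maybe; just; nothing)
import Data.Maybe as Maybe
open import Data.Maybe.Properties using (just-injective; ≡-dec)
open import Data.Nat using (zero; suc; _<_; _^_; _⊔_; _∸_; z≤n; s≤s; _<?_; ⌈_/2⌉; ⌊_/2⌋)
open import Data.Nat.Induction using (<-rec)
open import Data.Nat.Logarithm using (⌈log₂⌉-mono-≤; ⌈log₂2^n⌉≡n; ⌈log₂⌈n/2⌉⌉≡⌈log₂n⌉∸1)
open import Data.Nat.Properties
  using ( ≤-refl; ≤-reflexive; ≤-trans; <⇒≤; ≮⇒≥; <⇒≱; <-cmp; n≤1+n; module ≤-Reasoning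
        ; +-comm; +-identityʳ; +-mono-≤; +-monoˡ-≤; m+[n∸m]≡n
        ; ⊔-identityʳ; m≤n⇒m⊔n≡n; m≥n⇒m⊔n≡m; ⌊n/2⌋+⌈n/2⌉≡n; ⌊n/2⌋≤⌈n/2⌉; ⌈n/2⌉<n )
open import Data.Product using (∃; _,_; proj₁; proj₂)
import Data.Product as Product
open import Data.Product.Function.NonDependent.Propositional using (_×-↔_)
open import Data.Vec using (Vec; []; _∷_; zipWith; lookup; tabulate)
open import Data.Vec.Properties using (tabulate∘lookup; tabulate-cong)
open import Function using (_∘_)
open import Function.Bundles using (_↔_; mk↔ₛ′; Inverse; Injection)
open import Function.Definitions using (Injective)
open import Function.Properties.Inverse using (↔-trans; ↔-sym; ↔⇒↣)
open import Relation.Binary.Definitions using (tri<; tri≈; tri>)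
open import Relation.Binary.PropositionalEquality
open import Relation.Nullary using (¬_; contradiction; yes; no)

isOdd-suc : ∀ m → isOdd (suc m) ≡ not (isOdd m)
isOdd-suc zero = refl
isOdd-suc (suc zero) = refl
isOdd-suc (suc (suc m)) = isOdd-suc m

b≢not-b : ∀ b → b ≢ not b
b≢not-b true ()
b≢not-b false ()

isOdd-⊔-separates : ∀ {a b n} → a < b → b ≤ n →
  ¬ (∀ j → j ≤ n → isOdd (a ⊔ j) ≡ isOdd (b ⊔ j))
isOdd-⊔-separates {a} {b} a<b b≤n same = b≢not-b (isOdd a) (begin
  isOdd a           ≡⟨ cong isOdd (sym (⊔-identityʳ a)) ⟩
  isOdd (a ⊔ 0)     ≡⟨ same 0 z≤n ⟩
  isOdd (b ⊔ 0)     ≡⟨ cong isOdd (trans (⊔-identityʳ b) (sym (m≥n⇒m⊔n≡m a<b))) ⟩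
  isOdd (b ⊔ suc a) ≡⟨ sym (same (suc a) (≤-trans a<b b≤n)) ⟩
  isOdd (a ⊔ suc a) ≡⟨ cong isOdd (m≤n⇒m⊔n≡n (n≤1+n a)) ⟩
  isOdd (suc a)     ≡⟨ isOdd-suc a ⟩
  not (isOdd a)     ∎)
  where open ≡-Reasoning

isOdd-⊔-injective : ∀ {a b n} → a ≤ n → b ≤ n →
  (∀ j → j ≤ n → isOdd (a ⊔ j) ≡ isOdd (b ⊔ j)) → a ≡ b
isOdd-⊔-injective {a} {b} a≤n b≤n same with <-cmp a b
... | tri≈ _ a≡b _ = a≡b
... | tri< a<b _ _ = contradiction same (isOdd-⊔-separates a<b b≤n)
... | tri> _ _ b<a = contradiction (λ j j≤n → sym (same j j≤n)) (isOdd-⊔-separates b<a a≤n)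

m≤2^⌈log₂m⌉ : ∀ m → m ≤ 2 ^ ⌈log₂ m ⌉
m≤2^⌈log₂m⌉ = <-rec (λ m → m ≤ 2 ^ ⌈log₂ m ⌉) bound
  where
  bound : ∀ m → (∀ {k} → k < m → k ≤ 2 ^ ⌈log₂ k ⌉) → m ≤ 2 ^ ⌈log₂ m ⌉
  bound zero _ = z≤n
  bound (suc zero) _ = s≤s z≤n
  bound m@(suc (suc k)) rec = begin
    m                         ≡⟨ sym (⌊n/2⌋+⌈n/2⌉≡n m) ⟩
    ⌊ m /2⌋ + ⌈ m /2⌉         ≤⟨ +-monoˡ-≤ ⌈ m /2⌉ (⌊n/2⌋≤⌈n/2⌉ m) ⟩
    ⌈ m /2⌉ + ⌈ m /2⌉         ≤⟨ +-mono-≤ half≤ half≤ ⟩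
    2 ^ (L ∸ 1) + 2 ^ (L ∸ 1) ≡⟨ cong (2 ^ (L ∸ 1) +_) (sym (+-identityʳ _)) ⟩
    2 ^ suc (L ∸ 1)           ≡⟨ cong (2 ^_) (m+[n∸m]≡n 1≤L) ⟩
    2 ^ L                     ∎
    where
    open ≤-Reasoning
    L = ⌈log₂ m ⌉
    1≤L : 1 ≤ L
    1≤L = ⌈log₂⌉-mono-≤ {2} {m} (s≤s (s≤s z≤n))
    half≤ : ⌈ m /2⌉ ≤ 2 ^ (L ∸ 1)
    half≤ = subst (λ e → ⌈ m /2⌉ ≤ 2 ^ e) (⌈log₂⌈n/2⌉⌉≡⌈log₂n⌉∸1 m) (rec (⌈n/2⌉<n k))

⌈log₂⌉-least : ∀ {m c} → m ≤ 2 ^ c → ⌈log₂ m ⌉ ≤ c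
⌈log₂⌉-least {c = c} m≤2^c = subst (_ ≤_) (⌈log₂2^n⌉≡n c) (⌈log₂⌉-mono-≤ m≤2^c)

missed-by : ∀ {k n} → k < n → (g : Fin k → Maybe (Fin n)) → ∃ λ i → ∀ j → g j ≢ just i
missed-by {k} {n} k<n g =
  Product.map₂ (λ i-missed j eq → i-missed (j , eq))
    (¬∀⟶∃¬ n Hit (λ i → any? (λ j → ≡-dec _≟_ (g j) (just i)))
      (λ all-hit → <⇒≱ k<n (injective⇒≤ (preimage-injective all-hit))))
  where
  Hit : Fin n → Set
  Hit i = ∃ λ j → g j ≡ just i
  preimage-injective : (all-hit : ∀ i → Hit i) → Injective _≡_ _≡_ (proj₁ ∘ all-hit)
  preimage-injective all-hit {i} {i′} eq = just-injective (begin
    just i                 ≡⟨ sym (proj₂ (all-hit i)) ⟩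
    g (proj₁ (all-hit i))  ≡⟨ cong g eq ⟩
    g (proj₁ (all-hit i′)) ≡⟨ proj₂ (all-hit i′) ⟩
    just i′                ∎)
    where open ≡-Reasoning

Vec-Bool↔Fin[2^] : ∀ c → Vec Bool c ↔ Fin (2 ^ c)
Vec-Bool↔Fin[2^] zero = mk↔ₛ′ (λ _ → zero) (λ _ → []) (λ { zero → refl }) (λ { [] → refl })
Vec-Bool↔Fin[2^] (suc c) =
  ↔-trans uncons (↔-trans (↔-sym 2↔Bool ×-↔ Vec-Bool↔Fin[2^] c) (↔-sym *↔×))
  where
  uncons : Vec Bool (suc c) ↔ (Bool × Vec Bool c)
  uncons = mk↔ₛ′ (λ { (b ∷ v) → b , v }) (λ { (b , v) → b ∷ v }) (λ _ → refl) (λ { (_ ∷ _) → refl })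

oneWay-via-index : ∀ {X Y : Set} {F : X → Y → Bool} {c} (μ : X → ℕ) → (∀ x → μ x < 2 ^ c) →
  (g : ℕ → Y → Bool) → (∀ x y → g (μ x) y ≡ F x y) → OneWayProtocol F c
oneWay-via-index {X} {Y} {F} {c} μ μ<2^c g computes = alice , bob , correct
  where
  open Inverse (Vec-Bool↔Fin[2^] c) using (to; from; strictlyInverseˡ)
  alice : X → Vec Bool c
  alice x = from (fromℕ< (μ<2^c x))
  bob : Vec Bool c → Y → Bool
  bob v y = g (toℕ (to v)) y
  correct : ∀ x y → bob (alice x) y ≡ F x y
  correct x y = trans (cong (λ k → g (toℕ k) y) (strictlyInverseˡ _))
                      (trans (cong (λ m → g m y) (toℕ-fromℕ< (μ<2^c x))) (computes x y))

oneWay-distinct-rows : ∀ {X Y : Set} {F : X → Y → Bool} {m c} (row : Fin m → X) →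
  (∀ i i′ → (∀ y → F (row i) y ≡ F (row i′) y) → i ≡ i′) → OneWayProtocol F c → m ≤ 2 ^ c
oneWay-distinct-rows {F = F} {c = c} row distinct (alice , bob , correct) =
  injective⇒≤ {f = to ∘ alice ∘ row} (λ eq → distinct _ _ (same-row (injective eq)))
  where
  open Injection (↔⇒↣ (Vec-Bool↔Fin[2^] c)) using (to; injective)
  same-row : ∀ {i i′} → alice (row i) ≡ alice (row i′) → ∀ y → F (row i) y ≡ F (row i′) y
  same-row eq y = trans (sym (correct _ y)) (trans (cong (λ v → bob v y) eq) (correct _ y))

AND-∅ : ∀ {n} (x : Vec Bool n) → AND ∅ x ≡ true
AND-∅ [] = refl
AND-∅ (b ∷ x) = AND-∅ x

AND-⁅⁆ : ∀ {n} (i : Fin n) (x : Vec Bool n) → AND ⁅ i ⁆ x ≡ lookup x i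
AND-⁅⁆ zero (b ∷ x) = trans (cong (b ∧_) (AND-∅ x)) (∧-identityʳ b)
AND-⁅⁆ (suc i) (b ∷ x) = AND-⁅⁆ i x

⁅⁆-determines : ∀ {n} (f : Vec Bool n → Bool) → DeterminedBy f ⁅_⁆
⁅⁆-determines f x y same = cong f (begin
  x                   ≡⟨ sym (tabulate∘lookup x) ⟩
  tabulate (lookup x) ≡⟨ tabulate-cong (λ i → trans (sym (AND-⁅⁆ i x)) (trans (same i) (AND-⁅⁆ i y))) ⟩
  tabulate (lookup y) ≡⟨ tabulate∘lookup y ⟩
  y                   ∎)
  where open ≡-Reasoning

least : ∀ {n} → Subset n → Maybe (Fin n)
least [] = nothing
least (true ∷ S) = just zero
least (false ∷ S) = Maybe.map suc (least S)

-- The last zero of b ∷ xs, from that of xs; 0 encodes "no zero".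
pushLastZero : Bool → ℕ → ℕ
pushLastZero _ (suc k) = suc (suc k)
pushLastZero true zero = zero
pushLastZero false zero = 1

pushLastZero-false : ∀ i → pushLastZero false i ≡ suc i
pushLastZero-false zero = refl
pushLastZero-false (suc i) = refl

lastZeroIndex : ∀ {n} → Vec Bool n → ℕ
lastZeroIndex [] = 0
lastZeroIndex (b ∷ xs) = pushLastZero b (lastZeroIndex xs)

positive : ℕ → Maybe ℕ
positive zero = nothing
positive (suc k) = just (suc k)

lastZero≡positive-lastZeroIndex : ∀ {n} (x : Vec Bool n) → lastZero x ≡ positive (lastZeroIndex x)
lastZero≡positive-lastZeroIndex [] = refl
lastZero≡positive-lastZeroIndex (b ∷ xs) with lastZero xs | lastZero≡positive-lastZeroIndex xs
... | _ | refl with lastZeroIndex xs | b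
...   | suc k | _ = refl
...   | zero | true = refl
...   | zero | false = refl

OMB≡isOdd-lastZeroIndex : ∀ n (x : Vec Bool n) → OMB n x ≡ isOdd (lastZeroIndex x)
OMB≡isOdd-lastZeroIndex n x rewrite lastZero≡positive-lastZeroIndex x with lastZeroIndex x
... | zero = refl
... | suc k = refl

pushLastZero-∧ : ∀ b c i j → pushLastZero (b ∧ c) (i ⊔ j) ≡ pushLastZero b i ⊔ pushLastZero c j
pushLastZero-∧ b c (suc i) (suc j) = refl
pushLastZero-∧ b true (suc i) zero = refl
pushLastZero-∧ b false (suc i) zero = refl
pushLastZero-∧ true c zero j = refl
pushLastZero-∧ false true zero zero = refl
pushLastZero-∧ false false zero zero = refl
pushLastZero-∧ false c zero (suc j) = refl

lastZeroIndex-zipWith-∧ : ∀ {n} (x y : Vec Bool n) →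
  lastZeroIndex (zipWith _∧_ x y) ≡ lastZeroIndex x ⊔ lastZeroIndex y
lastZeroIndex-zipWith-∧ [] [] = refl
lastZeroIndex-zipWith-∧ (b ∷ x) (c ∷ y) =
  trans (cong (pushLastZero (b ∧ c)) (lastZeroIndex-zipWith-∧ x y))
        (pushLastZero-∧ b c (lastZeroIndex x) (lastZeroIndex y))

pushLastZero≤suc : ∀ b i → pushLastZero b i ≤ suc i
pushLastZero≤suc _ (suc k) = ≤-refl
pushLastZero≤suc true zero = z≤n
pushLastZero≤suc false zero = ≤-refl

lastZeroIndex≤length : ∀ {n} (x : Vec Bool n) → lastZeroIndex x ≤ n
lastZeroIndex≤length [] = z≤n
lastZeroIndex≤length (b ∷ x) = ≤-trans (pushLastZero≤suc b _) (s≤s (lastZeroIndex≤length x))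

OMB∘AND≡isOdd-⊔ : ∀ n (x y : Vec Bool n) →
  (OMB n ∘AND) x y ≡ isOdd (lastZeroIndex x ⊔ lastZeroIndex y)
OMB∘AND≡isOdd-⊔ n x y =
  trans (OMB≡isOdd-lastZeroIndex n (zipWith _∧_ x y)) (cong isOdd (lastZeroIndex-zipWith-∧ x y))

zeroPrefix : ∀ {n} → ℕ → Vec Bool n
zeroPrefix {zero} _ = []
zeroPrefix {suc n} zero = true ∷ zeroPrefix zero
zeroPrefix {suc n} (suc m) = false ∷ zeroPrefix m

lastZeroIndex-zeroPrefix : ∀ {n m} → m ≤ n → lastZeroIndex (zeroPrefix {n} m) ≡ m
lastZeroIndex-zeroPrefix {zero} z≤n = refl
lastZeroIndex-zeroPrefix {suc n} z≤n = cong (pushLastZero true) (lastZeroIndex-zeroPrefix {n} z≤n)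
lastZeroIndex-zeroPrefix {suc n} (s≤s {m} m≤n) =
  trans (cong (pushLastZero false) (lastZeroIndex-zeroPrefix m≤n)) (pushLastZero-false m)

OMB-zeroPrefix : ∀ {n m} → m ≤ n → OMB n (zeroPrefix m) ≡ isOdd m
OMB-zeroPrefix {n} {m} m≤n =
  trans (OMB≡isOdd-lastZeroIndex n (zeroPrefix m)) (cong isOdd (lastZeroIndex-zeroPrefix m≤n))

OMB∘AND-zeroPrefix : ∀ {n i j} → i ≤ n → j ≤ n →
  (OMB n ∘AND) (zeroPrefix i) (zeroPrefix j) ≡ isOdd (i ⊔ j)
OMB∘AND-zeroPrefix {n} {i} {j} i≤n j≤n = trans (OMB∘AND≡isOdd-⊔ n (zeroPrefix i) (zeroPrefix j))
  (cong isOdd (cong₂ _⊔_ (lastZeroIndex-zeroPrefix i≤n) (lastZeroIndex-zeroPrefix j≤n)))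

OMB-zeroPrefix-suc : ∀ {n m} → m < n → OMB n (zeroPrefix m) ≢ OMB n (zeroPrefix (suc m))
OMB-zeroPrefix-suc {m = m} m<n eq = b≢not-b (isOdd m) (begin
  isOdd m       ≡⟨ sym (OMB-zeroPrefix (<⇒≤ m<n)) ⟩
  _             ≡⟨ eq ⟩
  _             ≡⟨ OMB-zeroPrefix m<n ⟩
  isOdd (suc m) ≡⟨ isOdd-suc m ⟩
  not (isOdd m) ∎)
  where open ≡-Reasoning

AND-zeroPrefix-suc : ∀ {n} (S : Subset n) (i : Fin n) → least S ≢ just i →
  AND S (zeroPrefix (toℕ i)) ≡ AND S (zeroPrefix (suc (toℕ i)))
AND-zeroPrefix-suc (true ∷ S) zero i≢least = contradiction refl i≢least
AND-zeroPrefix-suc (false ∷ S) zero _ = refl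
AND-zeroPrefix-suc (true ∷ S) (suc i) _ = refl
AND-zeroPrefix-suc (false ∷ S) (suc i) i≢least =
  AND-zeroPrefix-suc S i (i≢least ∘ cong (Maybe.map suc))

NAADT-OMB-lower : ∀ n k → NAADT-admits (OMB n) k → n ≤ k
NAADT-OMB-lower n k (S , determines) with k <? n
... | no k≮n = ≮⇒≥ k≮n
... | yes k<n with missed-by k<n (least ∘ S)
...   | i , missed = contradiction
  (determines _ _ (λ j → AND-zeroPrefix-suc (S j) i (missed j)))
  (OMB-zeroPrefix-suc (toℕ<n i))

OMB∘AND-zeroPrefix-rows-distinct : ∀ n (i i′ : Fin (suc n)) →
  (∀ y → (OMB n ∘AND) (zeroPrefix (toℕ i)) y ≡ (OMB n ∘AND) (zeroPrefix (toℕ i′)) y) → i ≡ i′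
OMB∘AND-zeroPrefix-rows-distinct n i i′ same =
  toℕ-injective (isOdd-⊔-injective i≤n i′≤n (λ j j≤n → begin
    isOdd (toℕ i ⊔ j)                                 ≡⟨ sym (OMB∘AND-zeroPrefix i≤n j≤n) ⟩
    (OMB n ∘AND) (zeroPrefix (toℕ i)) (zeroPrefix j)  ≡⟨ same (zeroPrefix j) ⟩
    (OMB n ∘AND) (zeroPrefix (toℕ i′)) (zeroPrefix j) ≡⟨ OMB∘AND-zeroPrefix i′≤n j≤n ⟩
    isOdd (toℕ i′ ⊔ j)                                ∎))
  where
  open ≡-Reasoning
  i≤n = toℕ≤pred[n] i
  i′≤n = toℕ≤pred[n] i′

theorem9 : (n : ℕ) → 1 ≤ n →
    NAADT-is (OMB n) n × D-oneway-is (OMB n ∘AND) ⌈log₂ (n + 1) ⌉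
theorem9 n _ =
  ((⁅_⁆ , ⁅⁆-determines (OMB n)) , NAADT-OMB-lower n) ,
  oneWay-via-index lastZeroIndex lastZeroIndex<2^c
    (λ i y → isOdd (i ⊔ lastZeroIndex y)) (λ x y → sym (OMB∘AND≡isOdd-⊔ n x y)) ,
  λ c P → ⌈log₂⌉-least (subst (_≤ 2 ^ c) (+-comm 1 n)
    (oneWay-distinct-rows (zeroPrefix ∘ toℕ) (OMB∘AND-zeroPrefix-rows-distinct n) P))
  where
  lastZeroIndex<2^c : (x : Vec Bool n) → lastZeroIndex x < 2 ^ ⌈log₂ (n + 1) ⌉
  lastZeroIndex<2^c x =
    ≤-trans (s≤s (lastZeroIndex≤length x)) (subst (_≤ 2 ^ ⌈log₂ (n + 1) ⌉) (+-comm n 1) (m≤2^⌈log₂m⌉ (n + 1)))
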